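{- Let $L$ be an extremal even unimodular lattice of rank $64$ (so its minimum nonzero norm is $6$), and let $\Gamma$ be a subgroup of $\mathrm{O}(L)$. If a $\Gamma$-rigidifying basis of $L$ exists, then $\mathrm{O}(L)=\Gamma$.
   Context: A lattice means an integral positive-definite lattice; the bilinear form on $L$ is denoted $\langle\, ,\,\rangle_L$, and $\mathrm{O}(L)$ is its automorphism group, acting on $L$ from the right. Let $\mathrm{Min}(L)=\{v\in L : \langle v,v\rangle_L=6\}$. For $v,v'\in\mathrm{Min}(L)$ one has $\langle v,v'\rangle_L\in\{0,\pm1,\pm2,\pm3,\pm6\}$. For $k=0,1,2,3,6$ put $a_k(v)=\tfrac12\,|\{v'\in\mathrm{Min}(L): \langle v,v'\rangle_L=k \text{ or } -k\}|$. The triple $a(v)=[a_1(v),a_2(v),a_3(v)]$ is the intersection pattern of $v$. For a triple $a$ of non-negative integers, let $\mathcal{A}_L(a)=\{v\in\mathrm{Min}(L): a(v)=a\}$. An ordered list $(v_1,\dots,v_{64})$ of vectors in $\mathrm{Min}(L)$ is called a $\Gamma$-rigidifying basis if: (a) $v_1,\dots,v_{64}$ form a basis of $L\otimes\mathbb{Q}$; (b) $\Gamma$ acts transitively on the set $\mathcal{A}_L(a(v_1))$; (c) for each $i>1$, the set $\{v'\in\mathcal{A}_L(a(v_i)) : \langle v',v_j\rangle_L=\langle v_i,v_j\rangle_L \text{ for all } j<i\}$ consists of the single element $v_i$. -}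

module Defs where

open import Data.Nat as ℕ using (ℕ)
open import Data.Integer as ℤ using (ℤ; +_; _+_; _*_; -_; _≤_; _<_)
open import Data.Fin using (Fin; toℕ)
open import Data.Vec using (Vec; zipWith; foldr; replicate; map; tabulate; lookup)
open import Data.List using (List; length)
open import Data.List.Relation.Unary.Unique.Propositional using (Unique)
open import Data.List.Membership.Propositional using (_∈_)
open import Data.Product using (Σ; ∃; _×_; _,_)
open import Data.Sum using (_⊎_)
open import Relation.Binary.PropositionalEquality using (_≡_)
open import Relation.Nullary using (¬_)
open import Function.Bundles using (_⇔_)

-- Integer (row) vectors = coordinates of lattice vectors w.r.t. a fixed Z-basis.
Vect : ℕ → Set
Vect n = Vec ℤ n

-- Square integer matrices, stored as a vector of rows.
Mat : ℕ → Set
Mat n = Vec (Vec ℤ n) n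

dot : ∀ {n} → Vect n → Vect n → ℤ
dot v w = foldr _ _+_ (+ 0) (zipWith _*_ v w)

zeroV : ∀ {n} → Vect n
zeroV = replicate _ (+ 0)

_·ᶜ_ : ∀ {n} → Mat n → Vect n → Vect n
M ·ᶜ w = map (λ row → dot row w) M

col : ∀ {n} → Mat n → Fin n → Vect n
col M j = map (λ row → lookup row j) M

_·_ : ∀ {n} → Vect n → Mat n → Vect n
v · g = tabulate (λ j → dot v (col g j))

_⊗_ : ∀ {n} → Mat n → Mat n → Mat n
g ⊗ h = map (λ row → row · h) g

idMat : ∀ {n} → Mat n
idMat = tabulate (λ i → tabulate (λ j → δ i j))
  where
  δ : ∀ {n} → Fin n → Fin n → ℤ
  δ i j with toℕ i ℕ.≟ toℕ j
  ... | Relation.Nullary.yes _ = + 1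
  ... | Relation.Nullary.no  _ = + 0

-- A lattice of rank n presented by its Gram matrix G w.r.t. a Z-basis:
-- L = Z^n with  <v,w>_L = v G w^T.
ip : ∀ {n} → Mat n → Vect n → Vect n → ℤ
ip G v w = dot v (G ·ᶜ w)

norm : ∀ {n} → Mat n → Vect n → ℤ
norm G v = ip G v v

Symmetric : ∀ {n} → Mat n → Set
Symmetric {n} G = ∀ (i j : Fin n) → lookup (lookup G i) j ≡ lookup (lookup G j) i

PositiveDefinite : ∀ {n} → Mat n → Set
PositiveDefinite {n} G = ∀ (v : Vect n) → ¬ (v ≡ zeroV) → + 0 < norm G v

Even : ∀ {n} → Mat n → Set
Even {n} G = ∀ (v : Vect n) → ∃ λ (k : ℤ) → norm G v ≡ + 2 * k

-- unimodular: the Gram matrix is invertible over Z (equivalently L = L^#)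
Unimodular : ∀ {n} → Mat n → Set
Unimodular {n} G = Σ (Mat n) λ H → G ⊗ H ≡ idMat

MinimumSix : ∀ {n} → Mat n → Set
MinimumSix {n} G =
  (∀ (v : Vect n) → ¬ (v ≡ zeroV) → + 6 ≤ norm G v) × (∃ λ (v : Vect n) → norm G v ≡ + 6)

-- extremal even unimodular lattice of rank 64 (extremal: min = 2 + 2*floor(64/24) = 6)
record ExtremalEvenUnimodular64 (G : Mat 64) : Set where
  field
    symmetric  : Symmetric G
    posDef     : PositiveDefinite G
    even       : Even G
    unimodular : Unimodular G
    extremal   : MinimumSix G

-- O(L): automorphisms of L, as integer matrices acting on the right,
-- bijective on L and preserving the form.
InO : ∀ {n} → Mat n → Mat n → Set
InO {n} G g =
  (∀ (v w : Vect n) → ip G (v · g) (w · g) ≡ ip G v w) ×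
  (Σ (Mat n) λ h → (∀ (v : Vect n) → (v · g) · h ≡ v) × (∀ (v : Vect n) → (v · h) · g ≡ v))

record IsSubgroupO {n} (G : Mat n) (Γ : Mat n → Set) : Set where
  field
    ⊆O      : ∀ g → Γ g → InO G g
    hasId   : Γ idMat
    closed  : ∀ g h → Γ g → Γ h → Γ (g ⊗ h)
    inverse : ∀ g → Γ g → Σ (Mat n) λ h → Γ h × (∀ (v : Vect n) → (v · g) · h ≡ v)
                                             × (∀ (v : Vect n) → (v · h) · g ≡ v)

InMin : ∀ {n} → Mat n → Vect n → Set
InMin G v = norm G v ≡ + 6

HasCard : ∀ {n} → (Vect n → Set) → ℕ → Set
HasCard {n} P m = Σ (List (Vect n)) λ xs → length xs ≡ m × Unique xs × (∀ u → (P u ⇔ u ∈ xs))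

PairSet : ∀ {n} → Mat n → Vect n → ℕ → Vect n → Set
PairSet G v k u = InMin G u × (ip G v u ≡ + k ⊎ ip G v u ≡ - (+ k))

-- a(v) = [a1,a2,a3] : a_k(v) = 1/2 |{v' ∈ Min(L) : <v,v'> = ±k}|
Pattern : Set
Pattern = ℕ × ℕ × ℕ

IsPattern : ∀ {n} → Mat n → Vect n → Pattern → Set
IsPattern G v (a₁ , a₂ , a₃) =
  HasCard (PairSet G v 1) (2 ℕ.* a₁) ×
  HasCard (PairSet G v 2) (2 ℕ.* a₂) ×
  HasCard (PairSet G v 3) (2 ℕ.* a₃)

InA : ∀ {n} → Mat n → Pattern → Vect n → Set
InA G a v = InMin G v × IsPattern G v a

lincomb : ∀ {n m} → Vec ℤ m → Vec (Vect n) m → Vect n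
lincomb c vs = foldr _ (zipWith _+_) zeroV (zipWith (λ a v → map (a *_) v) c vs)

-- n vectors in a rank-n lattice form a basis of L ⊗ Q iff they are linearly
-- independent over Q, iff (clearing denominators) over Z.
IsQBasis : ∀ {n} → Vec (Vect n) n → Set
IsQBasis {n} vs = ∀ (c : Vec ℤ n) → lincomb c vs ≡ zeroV → c ≡ zeroV

-- Γ-rigidifying basis (v_1,…,v_64) ~ vs indexed by Fin n (index 0 = v_1)
record Rigidifying {n} (G : Mat n) (Γ : Mat n → Set) (vs : Vec (Vect n) n) : Set where
  field
    inMin  : ∀ (i : Fin n) → InMin G (lookup vs i)
    basis  : IsQBasis vs
    transitive : ∀ (i₀ : Fin n) → toℕ i₀ ≡ 0 → ∀ (a : Pattern) → IsPattern G (lookup vs i₀) a →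
                 ∀ (w : Vect n) → InA G a w →
                 ∃ λ (g : Mat n) → Γ g × (lookup vs i₀ · g ≡ w)
    rigid  : ∀ (i : Fin n) → 0 ℕ.< toℕ i → ∀ (a : Pattern) → IsPattern G (lookup vs i) a →
             ∀ (w : Vect n) → InA G a w →
             (∀ (j : Fin n) → toℕ j ℕ.< toℕ i → ip G w (lookup vs j) ≡ ip G (lookup vs i) (lookup vs j)) →
             w ≡ lookup vs i

-- Let g ∈ O(L). Isometries preserve intersection patterns, so v₁g ∈ A(a(v₁)), and transitivity
-- gives γ ∈ Γ with v₁γ = v₁g. The isometry F = gγ⁻¹ fixes v₁; if it fixes v₁, …, vᵢ₋₁, then Fvᵢ has
-- the pattern of vᵢ and the same inner products with v₁, …, vᵢ₋₁, so Fvᵢ = vᵢ by rigidity. A linear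
-- map fixing a ℚ-basis is the identity (every v satisfies c₀v + Σ cᵢvᵢ = 0 with c₀ ≠ 0, found by
-- Gaussian elimination over ℤ), hence g = γ ∈ Γ.
-- Applying rigidity also needs every vector to have a pattern, i.e. finiteness and evenness of
-- {v' ∈ Min(L) : ⟨v,v'⟩ = ±k}: coordinates are inner products with the columns of the inverse Gram
-- matrix, hence bounded by Cauchy–Schwarz, and the set splits into pairs ±v'.

module Submission where

open import Defs
open import Data.Nat as ℕ using (ℕ; zero; suc; z≤n; s≤s)
import Data.Nat.Properties as ℕP
open import Data.Integer as ℤ using (ℤ; 0ℤ; 1ℤ; -1ℤ; +_; +[1+_]; -[1+_]; _+_; _*_; -_; _-_)
import Data.Integer.Properties as ℤP
open import Data.Integer.Tactic.RingSolver using (solve-∀)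
open import Data.Fin as Fin using (Fin; zero; suc; toℕ)
open import Data.Fin.Induction using (<-wellFounded)
open import Induction.WellFounded using (module All)
import Data.Fin.Properties as FinP
open import Data.Vec as Vec using (Vec; []; _∷_; head; tail; lookup; tabulate; zipWith; map; replicate; insertAt; removeAt)
import Data.Vec.Properties as VecP
open import Data.List as List using (List)
import Data.List.Properties as ListP
open import Data.List.Membership.Propositional using (_∈_)
open import Data.List.Membership.Propositional.Properties
  using (∈-map⁺; ∈-map⁻; ∈-++⁺ˡ; ∈-++⁺ʳ; ∈-++⁻; ∈-upTo⁺; ∈-cartesianProductWith⁺;
         ∈-filter⁺; ∈-filter⁻; ∈-deduplicate⁺; ∈-deduplicate⁻)
open import Data.List.Relation.Unary.Any using (here)
import Data.List.Relation.Unary.Unique.Propositional.Properties as UniqueP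
import Data.List.Relation.Unary.Unique.DecPropositional.Properties as UniqueDecP
open import Data.Product using (Σ; ∃; _×_; _,_; proj₁; proj₂)
open import Data.Sum using (_⊎_; inj₁; inj₂)
open import Relation.Nullary using (¬_; Dec; yes; no; contradiction)
open import Relation.Nullary.Decidable using (T?; _×-dec_; _⊎-dec_)
open import Relation.Binary using (DecidableEquality; tri<; tri≈; tri>)
open import Relation.Unary using (Decidable)
open import Data.Empty using (⊥)
open import Relation.Binary.PropositionalEquality
open import Function using (_∘_)
open import Function.Bundles using (mk⇔; Equivalence)
open import Algebra.Properties.AbelianGroup ℤP.+-0-abelianGroup using (∙-cancelʳ)

-- ℤⁿ as a ℤ-module

infixl 6 _+v_
infixr 7 _*v_

_+v_ : ∀ {n} → Vect n → Vect n → Vect n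
_+v_ = zipWith _+_

_*v_ : ∀ {n} → ℤ → Vect n → Vect n
a *v x = map (a *_) x

lookup-extensionality : ∀ {A : Set} {n} {x y : Vec A n} → (∀ i → lookup x i ≡ lookup y i) → x ≡ y
lookup-extensionality {x = x} {y} x≗y = begin
  x                   ≡⟨ VecP.tabulate∘lookup x ⟨
  tabulate (lookup x) ≡⟨ VecP.tabulate-cong x≗y ⟩
  tabulate (lookup y) ≡⟨ VecP.tabulate∘lookup y ⟩
  y                   ∎
  where open ≡-Reasoning

+v-comm : ∀ {n} (x y : Vect n) → x +v y ≡ y +v x
+v-comm = VecP.zipWith-comm ℤP.+-comm

+v-identityˡ : ∀ {n} (x : Vect n) → zeroV +v x ≡ x
+v-identityˡ = VecP.zipWith-identityˡ ℤP.+-identityˡ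

+v-identityʳ : ∀ {n} (x : Vect n) → x +v zeroV ≡ x
+v-identityʳ = VecP.zipWith-identityʳ ℤP.+-identityʳ

+v-cancelʳ : ∀ {n} {x y : Vect n} (r : Vect n) → x +v r ≡ y +v r → x ≡ y
+v-cancelʳ {x = []} {[]} [] _ = refl
+v-cancelʳ {x = a ∷ x} {b ∷ y} (c ∷ r) eq =
  cong₂ _∷_ (∙-cancelʳ c a b (VecP.∷-injectiveˡ eq)) (+v-cancelʳ r (VecP.∷-injectiveʳ eq))

*v-zeroˡ : ∀ {n} (x : Vect n) → 0ℤ *v x ≡ zeroV
*v-zeroˡ x = VecP.map-const x 0ℤ

*v-zeroʳ : ∀ {n} (a : ℤ) → a *v zeroV {n} ≡ zeroV
*v-zeroʳ {n} a = trans (VecP.map-replicate (a *_) 0ℤ n) (cong (replicate n) (ℤP.*-zeroʳ a))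

*v-cancelˡ : ∀ {n} {a : ℤ} {x y : Vect n} → ¬ a ≡ 0ℤ → a *v x ≡ a *v y → x ≡ y
*v-cancelˡ {x = []} {[]} _ _ = refl
*v-cancelˡ {a = a} {b ∷ x} {c ∷ y} a≢0 eq =
  cong₂ _∷_ (ℤP.*-cancelˡ-≡ a b c {{ℤ.≢-nonZero a≢0}} (VecP.∷-injectiveˡ eq)) (*v-cancelˡ a≢0 (VecP.∷-injectiveʳ eq))

+v-exchange : ∀ {n} (x y z : Vect n) → x +v (y +v z) ≡ y +v (x +v z)
+v-exchange x y z = begin
  x +v (y +v z) ≡⟨ VecP.zipWith-assoc ℤP.+-assoc x y z ⟨
  (x +v y) +v z ≡⟨ cong (_+v z) (+v-comm x y) ⟩
  (y +v x) +v z ≡⟨ VecP.zipWith-assoc ℤP.+-assoc y x z ⟩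
  y +v (x +v z) ∎
  where open ≡-Reasoning

unit : ∀ {n} → Fin n → Vect n
unit zero    = 1ℤ ∷ zeroV
unit (suc i) = 0ℤ ∷ unit i

dot-comm : ∀ {n} (x y : Vect n) → dot x y ≡ dot y x
dot-comm x y = cong (Vec.foldr _ _+_ (+ 0)) (VecP.zipWith-comm ℤP.*-comm x y)

dot-zeroˡ : ∀ {n} (y : Vect n) → dot zeroV y ≡ 0ℤ
dot-zeroˡ []      = refl
dot-zeroˡ (_ ∷ y) = cong (λ t → 0ℤ + t) (dot-zeroˡ y)

dot-zeroʳ : ∀ {n} (x : Vect n) → dot x zeroV ≡ 0ℤ
dot-zeroʳ x = trans (dot-comm x zeroV) (dot-zeroˡ x)

dot-+ˡ : ∀ {n} (x y z : Vect n) → dot (x +v y) z ≡ dot x z + dot y z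
dot-+ˡ []      []      []      = refl
dot-+ˡ (a ∷ x) (b ∷ y) (c ∷ z) = trans (cong (λ t → (a + b) * c + t) (dot-+ˡ x y z)) (shuffle a b c (dot x z) (dot y z))
  where
  shuffle : ∀ a b c p q → (a + b) * c + (p + q) ≡ (a * c + p) + (b * c + q)
  shuffle = solve-∀

dot-*ˡ : ∀ {n} (a : ℤ) (x z : Vect n) → dot (a *v x) z ≡ a * dot x z
dot-*ˡ a []      []      = sym (ℤP.*-zeroʳ a)
dot-*ˡ a (b ∷ x) (c ∷ z) = trans (cong (λ t → a * b * c + t) (dot-*ˡ a x z)) (factor a b c (dot x z))
  where
  factor : ∀ a b c p → a * b * c + a * p ≡ a * (b * c + p)
  factor = solve-∀

dot-unitˡ : ∀ {n} (i : Fin n) (u : Vect n) → dot (unit i) u ≡ lookup u i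
dot-unitˡ zero    (a ∷ u) = trans (cong (λ t → 1ℤ * a + t) (dot-zeroˡ u)) (trans (ℤP.+-identityʳ _) (ℤP.*-identityˡ a))
dot-unitˡ (suc i) (a ∷ u) = trans (ℤP.+-identityˡ _) (dot-unitˡ i u)

column : ∀ {n m} → Vec (Vect n) m → Fin n → Vec ℤ m
column vs j = map (λ v → lookup v j) vs

lookup-lincomb : ∀ {n m} (c : Vec ℤ m) (vs : Vec (Vect n) m) (j : Fin n) →
                 lookup (lincomb c vs) j ≡ dot c (column vs j)
lookup-lincomb []      []       j = VecP.lookup-replicate j 0ℤ
lookup-lincomb (a ∷ c) (v ∷ vs) j = begin
  lookup (a *v v +v lincomb c vs) j              ≡⟨ VecP.lookup-zipWith _+_ j (a *v v) (lincomb c vs) ⟩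
  lookup (a *v v) j + lookup (lincomb c vs) j     ≡⟨ cong₂ _+_ (VecP.lookup-map j (a *_) v) (lookup-lincomb c vs j) ⟩
  a * lookup v j + dot c (column vs j)            ∎
  where open ≡-Reasoning

lincomb-+ˡ : ∀ {n m} (x y : Vec ℤ m) (vs : Vec (Vect n) m) → lincomb (x +v y) vs ≡ lincomb x vs +v lincomb y vs
lincomb-+ˡ x y vs = lookup-extensionality λ j → begin
  lookup (lincomb (x +v y) vs) j                       ≡⟨ lookup-lincomb (x +v y) vs j ⟩
  dot (x +v y) (column vs j)                           ≡⟨ dot-+ˡ x y (column vs j) ⟩
  dot x (column vs j) + dot y (column vs j)            ≡⟨ cong₂ _+_ (lookup-lincomb x vs j) (lookup-lincomb y vs j) ⟨
  lookup (lincomb x vs) j + lookup (lincomb y vs) j    ≡⟨ VecP.lookup-zipWith _+_ j (lincomb x vs) (lincomb y vs) ⟨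
  lookup (lincomb x vs +v lincomb y vs) j              ∎
  where open ≡-Reasoning

lincomb-*ˡ : ∀ {n m} (a : ℤ) (x : Vec ℤ m) (vs : Vec (Vect n) m) → lincomb (a *v x) vs ≡ a *v lincomb x vs
lincomb-*ˡ a x vs = lookup-extensionality λ j → begin
  lookup (lincomb (a *v x) vs) j   ≡⟨ lookup-lincomb (a *v x) vs j ⟩
  dot (a *v x) (column vs j)       ≡⟨ dot-*ˡ a x (column vs j) ⟩
  a * dot x (column vs j)          ≡⟨ cong (a *_) (lookup-lincomb x vs j) ⟨
  a * lookup (lincomb x vs) j      ≡⟨ VecP.lookup-map j (a *_) (lincomb x vs) ⟨
  lookup (a *v lincomb x vs) j     ∎
  where open ≡-Reasoning

lincomb-unitˡ : ∀ {n m} (i : Fin m) (vs : Vec (Vect n) m) → lincomb (unit i) vs ≡ lookup vs i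
lincomb-unitˡ i vs = lookup-extensionality λ j →
  trans (lookup-lincomb (unit i) vs j) (trans (dot-unitˡ i (column vs j)) (VecP.lookup-map i (λ v → lookup v j) vs))

dot-lincomb : ∀ {n m} (x : Vec ℤ m) (vs : Vec (Vect n) m) (y : Vect n) →
              dot x (map (λ v → dot v y) vs) ≡ dot (lincomb x vs) y
dot-lincomb []      []       y = sym (dot-zeroˡ y)
dot-lincomb (a ∷ x) (v ∷ vs) y = begin
  a * dot v y + dot x (map (λ v → dot v y) vs)   ≡⟨ cong (λ t → a * dot v y + t) (dot-lincomb x vs y) ⟩
  a * dot v y + dot (lincomb x vs) y             ≡⟨ cong (_+ dot (lincomb x vs) y) (dot-*ˡ a v y) ⟨
  dot (a *v v) y + dot (lincomb x vs) y          ≡⟨ dot-+ˡ (a *v v) (lincomb x vs) y ⟨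
  dot (a *v v +v lincomb x vs) y                 ∎
  where open ≡-Reasoning

·-lincomb : ∀ {n} (x : Vect n) (M : Mat n) → x · M ≡ lincomb x M
·-lincomb x M = lookup-extensionality λ j → trans (VecP.lookup∘tabulate _ j) (sym (lookup-lincomb x M j))

matrix-extensionality : ∀ {n} {g h : Mat n} → (∀ v → v · g ≡ v · h) → g ≡ h
matrix-extensionality {g = g} {h} vg≡vh = lookup-extensionality λ i → begin
  lookup g i          ≡⟨ lincomb-unitˡ i g ⟨
  lincomb (unit i) g  ≡⟨ ·-lincomb (unit i) g ⟨
  unit i · g          ≡⟨ vg≡vh (unit i) ⟩
  unit i · h          ≡⟨ ·-lincomb (unit i) h ⟩
  lincomb (unit i) h  ≡⟨ lincomb-unitˡ i h ⟩
  lookup h i          ∎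
  where open ≡-Reasoning

record Linear {n} (F : Vect n → Vect n) : Set where
  field
    preserves-+ : ∀ x y → F (x +v y) ≡ F x +v F y
    preserves-* : ∀ a x → F (a *v x) ≡ a *v F x

  preserves-zero : F zeroV ≡ zeroV
  preserves-zero = begin
    F zeroV            ≡⟨ cong F (*v-zeroˡ zeroV) ⟨
    F (0ℤ *v zeroV)    ≡⟨ preserves-* 0ℤ zeroV ⟩
    0ℤ *v F zeroV      ≡⟨ *v-zeroˡ (F zeroV) ⟩
    zeroV              ∎
    where open ≡-Reasoning

  preserves-lincomb : ∀ {m} (c : Vec ℤ m) (vs : Vec (Vect n) m) → F (lincomb c vs) ≡ lincomb c (map F vs)
  preserves-lincomb []      []       = preserves-zero
  preserves-lincomb (a ∷ c) (v ∷ vs) = begin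
    F (a *v v +v lincomb c vs)    ≡⟨ preserves-+ (a *v v) (lincomb c vs) ⟩
    F (a *v v) +v F (lincomb c vs) ≡⟨ cong₂ _+v_ (preserves-* a v) (preserves-lincomb c vs) ⟩
    a *v F v +v lincomb c (map F vs) ∎
    where open ≡-Reasoning

·-linear : ∀ {n} (M : Mat n) → Linear (_· M)
·-linear M = record
  { preserves-+ = λ x y → begin
      (x +v y) · M                   ≡⟨ ·-lincomb (x +v y) M ⟩
      lincomb (x +v y) M             ≡⟨ lincomb-+ˡ x y M ⟩
      lincomb x M +v lincomb y M     ≡⟨ cong₂ _+v_ (·-lincomb x M) (·-lincomb y M) ⟨
      x · M +v y · M                 ∎
  ; preserves-* = λ a x → begin
      (a *v x) · M                   ≡⟨ ·-lincomb (a *v x) M ⟩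
      lincomb (a *v x) M             ≡⟨ lincomb-*ˡ a x M ⟩
      a *v lincomb x M               ≡⟨ cong (a *v_) (·-lincomb x M) ⟨
      a *v (x · M)                   ∎
  }
  where open ≡-Reasoning

∘-linear : ∀ {n} {F F′ : Vect n → Vect n} → Linear F′ → Linear F → Linear (F′ ∘ F)
∘-linear {F = F} {F′} L′ L = record
  { preserves-+ = λ x y → trans (cong F′ (L.preserves-+ x y)) (L′.preserves-+ (F x) (F y))
  ; preserves-* = λ a x → trans (cong F′ (L.preserves-* a x)) (L′.preserves-* a (F x))
  }
  where
  module L = Linear L
  module L′ = Linear L′

lincomb-symmetric : ∀ {n} {G : Mat n} → Symmetric G → ∀ x → lincomb x G ≡ G ·ᶜ x
lincomb-symmetric {G = G} symmetric x = lookup-extensionality λ j → begin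
  lookup (lincomb x G) j     ≡⟨ lookup-lincomb x G j ⟩
  dot x (column G j)         ≡⟨ cong (dot x) (lookup-extensionality λ i → trans (VecP.lookup-map i _ G) (symmetric i j)) ⟩
  dot x (lookup G j)         ≡⟨ dot-comm x (lookup G j) ⟩
  dot (lookup G j) x         ≡⟨ VecP.lookup-map j (λ row → dot row x) G ⟨
  lookup (G ·ᶜ x) j          ∎
  where open ≡-Reasoning

ip-sym : ∀ {n} {G : Mat n} → Symmetric G → ∀ x y → ip G x y ≡ ip G y x
ip-sym {G = G} symmetric x y = begin
  dot x (G ·ᶜ y)         ≡⟨ dot-lincomb x G y ⟩
  dot (lincomb x G) y    ≡⟨ cong (λ z → dot z y) (lincomb-symmetric symmetric x) ⟩
  dot (G ·ᶜ x) y         ≡⟨ dot-comm (G ·ᶜ x) y ⟩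
  dot y (G ·ᶜ x)         ∎
  where open ≡-Reasoning

module _ {n} {G : Mat n} (symmetric : Symmetric G) where

  ip-+ʳ : ∀ x y z → ip G z (x +v y) ≡ ip G z x + ip G z y
  ip-+ʳ x y z = trans (ip-sym symmetric z (x +v y))
    (trans (dot-+ˡ x y (G ·ᶜ z)) (cong₂ _+_ (ip-sym symmetric x z) (ip-sym symmetric y z)))

  ip-*ʳ : ∀ a x z → ip G z (a *v x) ≡ a * ip G z x
  ip-*ʳ a x z = trans (ip-sym symmetric z (a *v x)) (trans (dot-*ˡ a x (G ·ᶜ z)) (cong (a *_) (ip-sym symmetric x z)))

-- Linear dependence of n + 1 vectors in ℤⁿ

Dependent : ∀ {n m} → Vec (Vect n) m → Set
Dependent {m = m} vs = ∃ λ (c : Vec ℤ m) → ¬ c ≡ zeroV × lincomb c vs ≡ zeroV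

insertAt≡replicate⇒≡replicate : ∀ {A : Set} {m} (xs : Vec A m) (i : Fin (suc m)) {x y : A} →
                                insertAt xs i x ≡ replicate (suc m) y → xs ≡ replicate m y
insertAt≡replicate⇒≡replicate xs       zero    eq = VecP.∷-injectiveʳ eq
insertAt≡replicate⇒≡replicate (x ∷ xs) (suc i) eq =
  cong₂ _∷_ (VecP.∷-injectiveˡ eq) (insertAt≡replicate⇒≡replicate xs i (VecP.∷-injectiveʳ eq))

lincomb-insertAt : ∀ {n m} (c : Vec ℤ m) (vs : Vec (Vect n) m) (i : Fin (suc m)) (a : ℤ) (u : Vect n) →
                   lincomb (insertAt c i a) (insertAt vs i u) ≡ a *v u +v lincomb c vs
lincomb-insertAt c       vs       zero    a u = refl
lincomb-insertAt (b ∷ c) (v ∷ vs) (suc i) a u =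
  trans (cong (b *v v +v_) (lincomb-insertAt c vs i a u)) (+v-exchange (b *v v) (a *v u) (lincomb c vs))

lincomb-split : ∀ {n m} (c : Vec ℤ m) (vs : Vec (Vect (suc n)) m) →
            lincomb c vs ≡ dot c (map head vs) ∷ lincomb c (map tail vs)
lincomb-split []      []             = refl
lincomb-split (a ∷ c) ((h ∷ t) ∷ vs) = cong (a *v (h ∷ t) +v_) (lincomb-split c vs)

lincomb-eliminate : ∀ {n m} (a : ℤ) (s : Vect n → ℤ) (u : Vect n) (c : Vec ℤ m) (ws : Vec (Vect n) m) →
                    lincomb c (map (λ w → a *v w +v s w *v u) ws) ≡ a *v lincomb c ws +v dot c (map s ws) *v u
lincomb-eliminate a s u []      []       =
  sym (trans (cong₂ _+v_ (*v-zeroʳ a) (*v-zeroˡ u)) (+v-identityʳ zeroV))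
lincomb-eliminate a s u (b ∷ c) (w ∷ ws) =
  trans (cong (b *v (a *v w +v s w *v u) +v_) (lincomb-eliminate a s u c ws))
        (step w (lincomb c ws) u)
  where
  scalar : ∀ a b p q x y z → b * (a * x + p * z) + (a * y + q * z) ≡ a * (b * x + y) + (b * p + q) * z
  scalar = solve-∀
  step : ∀ {k} (x y z : Vect k) →
         b *v (a *v x +v s w *v z) +v (a *v y +v dot c (map s ws) *v z) ≡
         a *v (b *v x +v y) +v (b * s w + dot c (map s ws)) *v z
  step []      []      []      = refl
  step (x ∷ xs) (y ∷ ys) (z ∷ zs) = cong₂ _∷_ (scalar a b (s w) (dot c (map s ws)) x y z) (step xs ys zs)

eliminate : ∀ {n} → Vect (suc n) → Vect (suc n) → Vect (suc n)
eliminate u w = head u *v w +v (- head w) *v u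

head-eliminate : ∀ {n} (u w : Vect (suc n)) → head (eliminate u w) ≡ 0ℤ
head-eliminate (a ∷ _) (b ∷ _) = cancel a b
  where
  cancel : ∀ a b → a * b + (- b) * a ≡ 0ℤ
  cancel = solve-∀

dependent-tails : ∀ {n m} (vs : Vec (Vect (suc n)) m) → (∀ i → head (lookup vs i) ≡ 0ℤ) →
                  Dependent (map tail vs) → Dependent vs
dependent-tails vs heads≡0 (c , c≢0 , relation) = c , c≢0 , combination
  where
  open ≡-Reasoning
  map-head≡0 : map head vs ≡ zeroV
  map-head≡0 = lookup-extensionality λ i →
    trans (VecP.lookup-map i head vs) (trans (heads≡0 i) (sym (VecP.lookup-replicate i 0ℤ)))
  combination : lincomb c vs ≡ zeroV
  combination = begin
    lincomb c vs                                   ≡⟨ lincomb-split c vs ⟩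
    dot c (map head vs) ∷ lincomb c (map tail vs)  ≡⟨ cong₂ _∷_ (trans (cong (dot c) map-head≡0) (dot-zeroʳ c)) relation ⟩
    zeroV                                          ∎

dependent-pivot : ∀ {n m} (vs : Vec (Vect (suc n)) (suc m)) (i : Fin (suc m)) → ¬ head (lookup vs i) ≡ 0ℤ →
                  Dependent (map (tail ∘ eliminate (lookup vs i)) (removeAt vs i)) → Dependent vs
dependent-pivot vs i a≢0 (c , c≢0 , relation) = insertAt (a *v c) i t , nonzero , combination
  where
  open ≡-Reasoning
  u = lookup vs i
  a = head u
  ws = removeAt vs i
  t = dot c (map (λ w → - head w) ws)
  eliminated : lincomb c (map (eliminate u) ws) ≡ zeroV
  eliminated = begin
    lincomb c (map (eliminate u) ws)                                    ≡⟨ lincomb-split c (map (eliminate u) ws) ⟩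
    dot c (map head (map (eliminate u) ws)) ∷ lincomb c (map tail (map (eliminate u) ws))
      ≡⟨ cong₂ (λ hs ts → dot c hs ∷ lincomb c ts) heads tails ⟩
    dot c zeroV ∷ lincomb c (map (tail ∘ eliminate u) ws)              ≡⟨ cong₂ _∷_ (dot-zeroʳ c) relation ⟩
    zeroV                                                               ∎
    where
    heads : map head (map (eliminate u) ws) ≡ zeroV
    heads = trans (sym (VecP.map-∘ head (eliminate u) ws))
                  (trans (VecP.map-cong (head-eliminate u) ws) (VecP.map-const ws 0ℤ))
    tails : map tail (map (eliminate u) ws) ≡ map (tail ∘ eliminate u) ws
    tails = sym (VecP.map-∘ tail (eliminate u) ws)
  combination : lincomb (insertAt (a *v c) i t) vs ≡ zeroV
  combination = begin
    lincomb (insertAt (a *v c) i t) vs             ≡⟨ cong (lincomb (insertAt (a *v c) i t)) (VecP.insertAt-removeAt vs i) ⟨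
    lincomb (insertAt (a *v c) i t) (insertAt ws i u) ≡⟨ lincomb-insertAt (a *v c) ws i t u ⟩
    t *v u +v lincomb (a *v c) ws                  ≡⟨ cong (t *v u +v_) (lincomb-*ˡ a c ws) ⟩
    t *v u +v a *v lincomb c ws                    ≡⟨ +v-comm (t *v u) (a *v lincomb c ws) ⟩
    a *v lincomb c ws +v t *v u                    ≡⟨ lincomb-eliminate a (λ w → - head w) u c ws ⟨
    lincomb c (map (eliminate u) ws)               ≡⟨ eliminated ⟩
    zeroV                                          ∎
  nonzero : ¬ insertAt (a *v c) i t ≡ zeroV
  nonzero eq = c≢0 (*v-cancelˡ a≢0 (trans (insertAt≡replicate⇒≡replicate (a *v c) i eq) (sym (*v-zeroʳ a))))

dependent : ∀ {n m} (vs : Vec (Vect n) (suc m)) → n ℕ.≤ m → Dependent vs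
dependent {zero}          vs _ = unit zero , (λ eq → 1≢0 (VecP.∷-injectiveˡ eq)) , empty (lincomb (unit zero) vs)
  where
  1≢0 : ¬ 1ℤ ≡ 0ℤ
  1≢0 ()
  empty : (x : Vect 0) → x ≡ zeroV
  empty [] = refl
dependent {suc n} {suc m} vs (s≤s n≤m) with FinP.all? (λ i → head (lookup vs i) ℤ.≟ 0ℤ)
... | yes heads≡0 = dependent-tails vs heads≡0 (dependent (map tail vs) (ℕP.m≤n⇒m≤1+n n≤m))
... | no ¬heads≡0 with FinP.¬∀⟶∃¬ _ _ (λ i → head (lookup vs i) ℤ.≟ 0ℤ) ¬heads≡0
...   | i , pivot≢0 = dependent-pivot vs i pivot≢0 (dependent _ n≤m)

linear-fixing-basis≗id : ∀ {n} {F : Vect n → Vect n} → Linear F → (vs : Vec (Vect n) n) → IsQBasis vs →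
                         (∀ i → F (lookup vs i) ≡ lookup vs i) → ∀ v → F v ≡ v
linear-fixing-basis≗id {n} {F} linear vs basis fixes v with dependent (v ∷ vs) ℕP.≤-refl
... | c₀ ∷ c , c≢0 , relation = *v-cancelˡ c₀≢0 (+v-cancelʳ (lincomb c vs) images)
  where
  open ≡-Reasoning
  open Linear linear
  c₀≢0 : ¬ c₀ ≡ 0ℤ
  c₀≢0 refl = c≢0 (cong (0ℤ ∷_) (basis c (trans (sym (+v-identityˡ (lincomb c vs)))
                                             (trans (cong (_+v lincomb c vs) (sym (*v-zeroˡ v))) relation))))
  images : c₀ *v F v +v lincomb c vs ≡ c₀ *v v +v lincomb c vs
  images = begin
    c₀ *v F v +v lincomb c vs          ≡⟨ cong (λ ws → c₀ *v F v +v lincomb c ws) map-F-vs ⟨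
    c₀ *v F v +v lincomb c (map F vs)  ≡⟨ preserves-lincomb (c₀ ∷ c) (v ∷ vs) ⟨
    F (lincomb (c₀ ∷ c) (v ∷ vs))      ≡⟨ cong F relation ⟩
    F zeroV                            ≡⟨ preserves-zero ⟩
    zeroV                              ≡⟨ relation ⟨
    c₀ *v v +v lincomb c vs            ∎
    where
    map-F-vs : map F vs ≡ vs
    map-F-vs = lookup-extensionality λ i → trans (VecP.lookup-map i F vs) (fixes i)

-- Isometries and intersection patterns

record Isometry {n} (G : Mat n) (F : Vect n → Vect n) : Set where
  field
    inverse      : Vect n → Vect n
    inverseˡ     : ∀ v → inverse (F v) ≡ v
    inverseʳ     : ∀ u → F (inverse u) ≡ u
    preserves-ip : ∀ x y → ip G (F x) (F y) ≡ ip G x y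

  injective : ∀ {x y} → F x ≡ F y → x ≡ y
  injective {x} {y} eq = trans (sym (inverseˡ x)) (trans (cong inverse eq) (inverseˡ y))

  preserves-Min : ∀ {v} → InMin G v → InMin G (F v)
  preserves-Min {v} = trans (preserves-ip v v)

  reflects-Min : ∀ {u} → InMin G u → InMin G (inverse u)
  reflects-Min {u} = trans (trans (sym (preserves-ip (inverse u) (inverse u))) (cong₂ (ip G) (inverseʳ u) (inverseʳ u)))

  PairSet-image : ∀ {v k u} → PairSet G v k u → PairSet G (F v) k (F u)
  PairSet-image {v} {k} {u} (u∈Min , ±k) =
    preserves-Min u∈Min , subst (λ t → t ≡ + k ⊎ t ≡ - (+ k)) (sym (preserves-ip v u)) ±k

  PairSet-preimage : ∀ {v k u} → PairSet G (F v) k u → PairSet G v k (inverse u)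
  PairSet-preimage {v} {k} {u} (u∈Min , ±k) = reflects-Min u∈Min , subst (λ t → t ≡ + k ⊎ t ≡ - (+ k)) moved ±k
    where
    moved : ip G (F v) u ≡ ip G v (inverse u)
    moved = trans (cong (ip G (F v)) (sym (inverseʳ u))) (preserves-ip v (inverse u))

  preserves-PairSet-card : ∀ {v k m} → HasCard (PairSet G v k) m → HasCard (PairSet G (F v) k) m
  preserves-PairSet-card {v} {k} (xs , length≡m , unique , members) =
    List.map F xs , trans (ListP.length-map F xs) length≡m , UniqueP.map⁺ injective unique ,
    λ u → mk⇔ (to u) (from u)
    where
    to : ∀ u → PairSet G (F v) k u → u ∈ List.map F xs
    to u p = subst (_∈ List.map F xs) (inverseʳ u) (∈-map⁺ F (Equivalence.to (members (inverse u)) (PairSet-preimage p)))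
    from : ∀ u → u ∈ List.map F xs → PairSet G (F v) k u
    from u u∈ with ∈-map⁻ F u∈
    ... | y , y∈xs , refl = PairSet-image (Equivalence.from (members y) y∈xs)

  preserves-A : ∀ {a v} → InA G a v → InA G a (F v)
  preserves-A (v∈Min , c₁ , c₂ , c₃) =
    preserves-Min v∈Min , preserves-PairSet-card c₁ , preserves-PairSet-card c₂ , preserves-PairSet-card c₃

O⇒isometry : ∀ {n} {G : Mat n} {g : Mat n} → InO G g → Isometry G (_· g)
O⇒isometry (preserves , h , gh , hg) = record
  { inverse = _· h ; inverseˡ = gh ; inverseʳ = hg ; preserves-ip = preserves }

∘-isometry : ∀ {n} {G : Mat n} {F F′ : Vect n → Vect n} → Isometry G F′ → Isometry G F → Isometry G (F′ ∘ F)
∘-isometry {G = G} {F} {F′} I′ I = record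
  { inverse      = I.inverse ∘ I′.inverse
  ; inverseˡ     = λ v → trans (cong I.inverse (I′.inverseˡ (F v))) (I.inverseˡ v)
  ; inverseʳ     = λ u → trans (cong F′ (I.inverseʳ (I′.inverse u))) (I′.inverseʳ u)
  ; preserves-ip = λ x y → trans (I′.preserves-ip (F x) (F y)) (I.preserves-ip x y)
  }
  where
  module I = Isometry I
  module I′ = Isometry I′

-- Finiteness and evenness of the pair sets

lookup-unit-diag : ∀ {n} (i : Fin n) → lookup (unit i) i ≡ 1ℤ
lookup-unit-diag zero    = refl
lookup-unit-diag (suc i) = lookup-unit-diag i

lookup-unit-off : ∀ {n} (i k : Fin n) → ¬ toℕ k ≡ toℕ i → lookup (unit i) k ≡ 0ℤ
lookup-unit-off zero    zero    k≢i = contradiction refl k≢i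
lookup-unit-off zero    (suc k) k≢i = VecP.lookup-replicate k 0ℤ
lookup-unit-off (suc i) zero    k≢i = refl
lookup-unit-off (suc i) (suc k) k≢i = lookup-unit-off i k (k≢i ∘ cong suc)

-- The entries of idMat are defined by a `with` on ℕ._≟_, which normalises to T? (_ ≡ᵇ _).
-- Case-splitting on that decision, abstracted in the type of the unfolded entry, lets the entry compute.
idMat-unfolded : ∀ {n} (k i : Fin n) → Σ ℤ (lookup (lookup idMat k) i ≡_)
idMat-unfolded k i = _ , trans (cong (λ row → lookup row i) (VecP.lookup∘tabulate _ k)) (VecP.lookup∘tabulate _ i)

idMat-entry : ∀ {n} (k i : Fin n) →
              (toℕ k ≡ toℕ i × lookup (lookup idMat k) i ≡ 1ℤ) ⊎ (¬ toℕ k ≡ toℕ i × lookup (lookup idMat k) i ≡ 0ℤ)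
idMat-entry k i with T? (toℕ k ℕ.≡ᵇ toℕ i) | proj₂ (idMat-unfolded k i)
... | yes k≡ᵇi | entry = inj₁ (ℕP.≡ᵇ⇒≡ _ _ k≡ᵇi , entry)
... | no k≢ᵇi  | entry = inj₂ (k≢ᵇi ∘ ℕP.≡⇒≡ᵇ _ _ , entry)

col-idMat : ∀ {n} (i : Fin n) → col idMat i ≡ unit i
col-idMat i = lookup-extensionality λ k → trans (VecP.lookup-map k (λ row → lookup row i) idMat) (entry k)
  where
  entry : ∀ k → lookup (lookup idMat k) i ≡ lookup (unit i) k
  entry k with idMat-entry k i
  ... | inj₁ (k≡i , e) rewrite FinP.toℕ-injective k≡i = trans e (sym (lookup-unit-diag i))
  ... | inj₂ (k≢i , e) = trans e (sym (lookup-unit-off i k k≢i))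

ip-col-inverse : ∀ {n} {G H : Mat n} → G ⊗ H ≡ idMat → ∀ u i → ip G u (col H i) ≡ lookup u i
ip-col-inverse {G = G} {H} GH≡1 u i = begin
  dot u (G ·ᶜ col H i)       ≡⟨ cong (dot u) columns ⟩
  dot u (col (G ⊗ H) i)      ≡⟨ cong (λ M → dot u (col M i)) GH≡1 ⟩
  dot u (col idMat i)        ≡⟨ cong (dot u) (col-idMat i) ⟩
  dot u (unit i)             ≡⟨ dot-comm u (unit i) ⟩
  dot (unit i) u             ≡⟨ dot-unitˡ i u ⟩
  lookup u i                 ∎
  where
  open ≡-Reasoning
  columns : G ·ᶜ col H i ≡ col (G ⊗ H) i
  columns = trans (VecP.map-cong (λ row → sym (VecP.lookup∘tabulate _ i)) G)
                  (VecP.map-∘ (λ row → lookup row i) (λ row → row · H) G)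

module _ {n} {G : Mat n} (symmetric : Symmetric G) (nonnegative : ∀ v → 0ℤ ℤ.≤ norm G v) where

  cauchy-schwarz : ∀ u w → 0ℤ ℤ.< norm G u → ip G u w * ip G u w ℤ.≤ norm G u * norm G w
  cauchy-schwarz u w 0<s = ℤP.0≤i-j⇒j≤i (ℤP.*-cancelˡ-≤-pos 0ℤ _ s {{ℤ.positive 0<s}}
    (subst₂ ℤ._≤_ (sym (ℤP.*-zeroʳ s)) norm-z (nonnegative z)))
    where
    open ≡-Reasoning
    s = norm G u
    a = ip G u w
    z = s *v w +v (- a) *v u
    -- z is s times the component of w orthogonal to u.
    norm-z : norm G z ≡ s * (s * norm G w - a * a)
    norm-z = begin
      ip G (s *v w +v (- a) *v u) z
        ≡⟨ dot-+ˡ (s *v w) ((- a) *v u) (G ·ᶜ z) ⟩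
      dot (s *v w) (G ·ᶜ z) + dot ((- a) *v u) (G ·ᶜ z)
        ≡⟨ cong₂ _+_ (dot-*ˡ s w (G ·ᶜ z)) (dot-*ˡ (- a) u (G ·ᶜ z)) ⟩
      s * ip G w z + (- a) * ip G u z
        ≡⟨ cong₂ (λ p q → s * p + (- a) * q)
             (ip-+ʳ symmetric (s *v w) ((- a) *v u) w) (ip-+ʳ symmetric (s *v w) ((- a) *v u) u) ⟩
      s * (ip G w (s *v w) + ip G w ((- a) *v u)) + (- a) * (ip G u (s *v w) + ip G u ((- a) *v u))
        ≡⟨ cong₂ (λ p q → s * p + (- a) * q)
             (cong₂ _+_ (ip-*ʳ symmetric s w w) (ip-*ʳ symmetric (- a) u w))
             (cong₂ _+_ (ip-*ʳ symmetric s w u) (ip-*ʳ symmetric (- a) u u)) ⟩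
      s * (s * norm G w + (- a) * ip G w u) + (- a) * (s * a + (- a) * s)
        ≡⟨ cong (λ p → s * (s * norm G w + (- a) * p) + (- a) * (s * a + (- a) * s)) (ip-sym symmetric w u) ⟩
      s * (s * norm G w + (- a) * a) + (- a) * (s * a + (- a) * s)
        ≡⟨ expand s (norm G w) a ⟩
      s * (s * norm G w - a * a)
        ∎
      where
      expand : ∀ s N a → s * (s * N + (- a) * a) + (- a) * (s * a + (- a) * s) ≡ s * (s * N - a * a)
      expand = solve-∀

  ∣ip∣-bound : ∀ u w → 0ℤ ℤ.< norm G u → ℤ.∣ ip G u w ∣ ℕ.≤ ℤ.∣ norm G u * norm G w ∣
  ∣ip∣-bound u w 0<s = ∣-∣-bound-of-square (ip G u w) (cauchy-schwarz u w 0<s)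
    where
    square : ∀ a → a * a ≡ + (ℤ.∣ a ∣ ℕ.* ℤ.∣ a ∣)
    square (+ 0)      = refl
    square +[1+ _ ]   = refl
    square -[1+ _ ]   = refl
    m≤m*m : ∀ m → m ℕ.≤ m ℕ.* m
    m≤m*m zero          = z≤n
    m≤m*m m@(suc _)     = ℕP.m≤m*n m m
    ∣-∣-bound-of-square : ∀ a {c} → a * a ℤ.≤ c → ℤ.∣ a ∣ ℕ.≤ ℤ.∣ c ∣
    ∣-∣-bound-of-square a a²≤c with subst (ℤ._≤ _) (square a) a²≤c
    ... | ℤ.+≤+ A²≤q = ℕP.≤-trans (m≤m*m ℤ.∣ a ∣) A²≤q

range : ℕ → List ℤ
range b = List.map +_ (List.upTo (suc b)) List.++ List.map (λ k → - (+ k)) (List.upTo (suc b))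

∈-range : ∀ {b} x → ℤ.∣ x ∣ ℕ.≤ b → x ∈ range b
∈-range (+ k)      ∣x∣≤b = ∈-++⁺ˡ (∈-map⁺ +_ (∈-upTo⁺ (s≤s ∣x∣≤b)))
∈-range {b} -[1+ k ] ∣x∣≤b = ∈-++⁺ʳ (List.map +_ (List.upTo (suc b))) (∈-map⁺ (λ k → - (+ k)) (∈-upTo⁺ (s≤s ∣x∣≤b)))

box : ∀ {n} → Vec ℕ n → List (Vect n)
box []       = List.[ [] ]
box (b ∷ bs) = List.cartesianProductWith _∷_ (range b) (box bs)

∈-box : ∀ {n} (bs : Vec ℕ n) (u : Vect n) → (∀ i → ℤ.∣ lookup u i ∣ ℕ.≤ lookup bs i) → u ∈ box bs
∈-box []       []      _       = here refl
∈-box (b ∷ bs) (x ∷ u) bounded =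
  ∈-cartesianProductWith⁺ _∷_ (∈-range x (bounded zero)) (∈-box bs u (bounded ∘ suc))

-v_ : ∀ {n} → Vect n → Vect n
-v_ = map (λ x → - x)

-v-involutive : ∀ {n} (u : Vect n) → -v -v u ≡ u
-v-involutive u = trans (sym (VecP.map-∘ (λ x → - x) (λ x → - x) u))
                        (trans (VecP.map-cong ℤP.neg-involutive u) (VecP.map-id u))

-v≡-1*v : ∀ {n} (u : Vect n) → -v u ≡ -1ℤ *v u
-v≡-1*v = VecP.map-cong (sym ∘ ℤP.-1*i≡-i)

LeadingPositive : ∀ {n} → Vect n → Set
LeadingPositive []       = ⊥
LeadingPositive (x ∷ xs) = 0ℤ ℤ.< x ⊎ (x ≡ 0ℤ × LeadingPositive xs)

leadingPositive? : ∀ {n} (u : Vect n) → Dec (LeadingPositive u)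
leadingPositive? []       = no λ ()
leadingPositive? (x ∷ xs) = (0ℤ ℤP.<? x) ⊎-dec ((x ℤ.≟ 0ℤ) ×-dec leadingPositive? xs)

leadingPositive-or-neg : ∀ {n} (u : Vect n) → ¬ u ≡ zeroV → LeadingPositive u ⊎ LeadingPositive (-v u)
leadingPositive-or-neg []       u≢0 = contradiction refl u≢0
leadingPositive-or-neg (x ∷ xs) u≢0 with ℤP.<-cmp 0ℤ x
... | tri< 0<x _ _ = inj₁ (inj₁ 0<x)
... | tri> _ _ x<0 = inj₂ (inj₁ (ℤP.neg-mono-< x<0))
... | tri≈ _ refl _ with leadingPositive-or-neg xs (u≢0 ∘ cong (0ℤ ∷_))
...   | inj₁ p = inj₁ (inj₂ (refl , p))
...   | inj₂ p = inj₂ (inj₂ (refl , p))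

leadingPositive-neg : ∀ {n} (u : Vect n) → LeadingPositive u → ¬ LeadingPositive (-v u)
leadingPositive-neg (x ∷ xs) (inj₁ 0<x) (inj₁ 0<-x) =
  ℤP.<-asym 0<x (subst (ℤ._< 0ℤ) (ℤP.neg-involutive x) (ℤP.neg-mono-< 0<-x))
leadingPositive-neg (x ∷ xs) (inj₁ 0<x) (inj₂ (-x≡0 , _)) =
  ℤP.<-irrefl (sym (trans (sym (ℤP.neg-involutive x)) (cong (λ y → - y) -x≡0))) 0<x
leadingPositive-neg (_ ∷ xs) (inj₂ (refl , _)) (inj₁ 0<0)      = ℤP.<-irrefl refl 0<0
leadingPositive-neg (_ ∷ xs) (inj₂ (refl , p)) (inj₂ (_ , -p)) = leadingPositive-neg xs p -p

_≟v_ : ∀ {n} → DecidableEquality (Vect n)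
_≟v_ = VecP.≡-dec ℤ._≟_

-- P splits into pairs ±u; each pair is represented by its member whose first nonzero coordinate is positive.
symmetric-finite-even-card : ∀ {n} {P : Vect n → Set} → Decidable P → (∀ {u} → P u → P (-v u)) →
                             (∀ {u} → P u → ¬ u ≡ zeroV) → (xs : List (Vect n)) → (∀ {u} → P u → u ∈ xs) →
                             ∃ λ m → HasCard P (2 ℕ.* m)
symmetric-finite-even-card {P = P} P? P-neg P-nonzero xs P⊆xs =
  List.length reps , reps List.++ List.map -v_ reps , length≡ , unique , λ u → mk⇔ (to u) (from u)
  where
  Rep : Vect _ → Set
  Rep u = P u × LeadingPositive u
  rep? : Decidable Rep
  rep? u = P? u ×-dec leadingPositive? u
  reps = List.deduplicate _≟v_ (List.filter rep? xs)
  ∈-reps⁻ : ∀ {u} → u ∈ reps → Rep u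
  ∈-reps⁻ u∈ = proj₂ (∈-filter⁻ rep? {xs = xs} (∈-deduplicate⁻ _≟v_ _ u∈))
  ∈-reps⁺ : ∀ {u} → Rep u → u ∈ reps
  ∈-reps⁺ r = ∈-deduplicate⁺ _≟v_ (∈-filter⁺ rep? (P⊆xs (proj₁ r)) r)
  length≡ : List.length (reps List.++ List.map -v_ reps) ≡ 2 ℕ.* List.length reps
  length≡ = trans (ListP.length-++ reps)
    (cong (List.length reps ℕ.+_) (trans (ListP.length-map -v_ reps) (sym (ℕP.+-identityʳ _))))
  -v-injective : ∀ {x y : Vect _} → -v x ≡ -v y → x ≡ y
  -v-injective {x} {y} eq = trans (sym (-v-involutive x)) (trans (cong -v_ eq) (-v-involutive y))
  disjoint : ∀ {u} → ¬ (u ∈ reps × u ∈ List.map -v_ reps)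
  disjoint (u∈ , -u∈) with ∈-map⁻ -v_ -u∈
  ... | y , y∈ , refl = leadingPositive-neg y (proj₂ (∈-reps⁻ y∈)) (proj₂ (∈-reps⁻ u∈))
  unique = UniqueP.++⁺ (UniqueDecP.deduplicate-! _≟v_ _)
                       (UniqueP.map⁺ -v-injective (UniqueDecP.deduplicate-! _≟v_ _)) disjoint
  to : ∀ u → P u → u ∈ reps List.++ List.map -v_ reps
  to u p with leadingPositive-or-neg u (P-nonzero p)
  ... | inj₁ pos = ∈-++⁺ˡ (∈-reps⁺ (p , pos))
  ... | inj₂ pos =
    ∈-++⁺ʳ reps (subst (_∈ List.map -v_ reps) (-v-involutive u) (∈-map⁺ -v_ (∈-reps⁺ (P-neg p , pos))))
  from : ∀ u → u ∈ reps List.++ List.map -v_ reps → P u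
  from u u∈ with ∈-++⁻ reps u∈
  ... | inj₁ u∈reps = proj₁ (∈-reps⁻ u∈reps)
  ... | inj₂ u∈-reps with ∈-map⁻ -v_ u∈-reps
  ...   | y , y∈ , refl = P-neg (proj₁ (∈-reps⁻ y∈))

module _ {n} {G : Mat n} (symmetric : Symmetric G) (posDef : PositiveDefinite G) (unimodular : Unimodular G) where

  norm-nonnegative : ∀ v → 0ℤ ℤ.≤ norm G v
  norm-nonnegative v with v ≟v zeroV
  ... | yes refl = ℤP.≤-reflexive (sym (dot-zeroˡ (G ·ᶜ zeroV)))
  ... | no v≢0   = ℤP.<⇒≤ (posDef v v≢0)

  ip-negʳ : ∀ v u → ip G v (-v u) ≡ - ip G v u
  ip-negʳ v u = trans (cong (ip G v) (-v≡-1*v u)) (trans (ip-*ʳ symmetric -1ℤ u v) (ℤP.-1*i≡-i _))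

  norm-neg : ∀ u → norm G (-v u) ≡ norm G u
  norm-neg u = begin
    ip G (-v u) (-v u)    ≡⟨ ip-negʳ (-v u) u ⟩
    - ip G (-v u) u       ≡⟨ cong (λ t → - t) (ip-sym symmetric (-v u) u) ⟩
    - ip G u (-v u)       ≡⟨ cong (λ t → - t) (ip-negʳ u u) ⟩
    - - norm G u          ≡⟨ ℤP.neg-involutive (norm G u) ⟩
    norm G u              ∎
    where open ≡-Reasoning

  PairSet-neg : ∀ {v k u} → PairSet G v k u → PairSet G v k (-v u)
  PairSet-neg {v} {k} {u} (u∈Min , ±k) = trans (norm-neg u) u∈Min , ∓k ±k
    where
    ∓k : ip G v u ≡ + k ⊎ ip G v u ≡ - (+ k) → ip G v (-v u) ≡ + k ⊎ ip G v (-v u) ≡ - (+ k)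
    ∓k (inj₁ ≡k)  = inj₂ (trans (ip-negʳ v u) (cong (λ t → - t) ≡k))
    ∓k (inj₂ ≡-k) = inj₁ (trans (ip-negʳ v u) (trans (cong (λ t → - t) ≡-k) (ℤP.neg-involutive (+ k))))

  pairSet? : ∀ v k → Decidable (PairSet G v k)
  pairSet? v k u = (norm G u ℤ.≟ + 6) ×-dec ((ip G v u ℤ.≟ + k) ⊎-dec (ip G v u ℤ.≟ - (+ k)))

  Min-nonzero : ∀ {u} → InMin G u → ¬ u ≡ zeroV
  Min-nonzero u∈Min refl with trans (sym (dot-zeroˡ (G ·ᶜ zeroV))) u∈Min
  ... | ()

  G⁻¹ : Mat n
  G⁻¹ = proj₁ unimodular

  -- Coordinates are inner products with the columns of G⁻¹, so Cauchy–Schwarz bounds them.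
  Min-bounds : Vec ℕ n
  Min-bounds = tabulate λ i → ℤ.∣ + 6 * norm G (col G⁻¹ i) ∣

  Min⊆box : ∀ {u} → InMin G u → u ∈ box Min-bounds
  Min⊆box {u} u∈Min = ∈-box Min-bounds u λ i → subst₂ ℕ._≤_
    (cong ℤ.∣_∣ (ip-col-inverse (proj₂ unimodular) u i))
    (trans (cong (λ s → ℤ.∣ s * norm G (col G⁻¹ i) ∣) u∈Min) (sym (VecP.lookup∘tabulate _ i)))
    (∣ip∣-bound symmetric norm-nonnegative u (col G⁻¹ i) (subst (0ℤ ℤ.<_) (sym u∈Min) (ℤ.+<+ (s≤s z≤n))))

  pattern-exists : ∀ v → ∃ (IsPattern G v)
  pattern-exists v = (proj₁ (card 1) , proj₁ (card 2) , proj₁ (card 3)) , proj₂ (card 1) , proj₂ (card 2) , proj₂ (card 3)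
    where
    card : ∀ k → ∃ λ m → HasCard (PairSet G v k) (2 ℕ.* m)
    card k = symmetric-finite-even-card (pairSet? v k) (PairSet-neg {v} {k})
      (λ u∈P → Min-nonzero (proj₁ u∈P)) (box Min-bounds) (λ u∈P → Min⊆box (proj₁ u∈P))

-- Rigidifying bases

module _ {n} {G : Mat (suc n)} (symmetric : Symmetric G) (posDef : PositiveDefinite G) (unimodular : Unimodular G)
         {Γ : Mat (suc n) → Set} (Γ≤O : IsSubgroupO G Γ)
         {vs : Vec (Vect (suc n)) (suc n)} (rigidifying : Rigidifying G Γ vs) where

  open Rigidifying rigidifying
  open IsSubgroupO Γ≤O using (⊆O; inverse)

  v₁ : Vect (suc n)
  v₁ = lookup vs zero

  pattern-of : ∀ v → ∃ (IsPattern G v)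
  pattern-of = pattern-exists symmetric posDef unimodular

  isometry-fixing-v₁-fixes-basis : ∀ {F} → Isometry G F → F v₁ ≡ v₁ → ∀ i → F (lookup vs i) ≡ lookup vs i
  isometry-fixing-v₁-fixes-basis {F} isometry F-fixes-v₁ = All.wfRec <-wellFounded _ _ step
    where
    open Isometry isometry using (preserves-A; preserves-ip)
    step : ∀ i → (∀ {j} → j Fin.< i → F (lookup vs j) ≡ lookup vs j) → F (lookup vs i) ≡ lookup vs i
    step zero      _           = F-fixes-v₁
    step i@(suc _) fixed-below = rigid i (s≤s z≤n) a a-pattern (F vᵢ) (preserves-A {a} {vᵢ} (inMin i , a-pattern))
      λ j j<i → trans (cong (ip G (F vᵢ)) (sym (fixed-below j<i))) (preserves-ip vᵢ (lookup vs j))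
      where
      vᵢ = lookup vs i
      a = proj₁ (pattern-of vᵢ)
      a-pattern = proj₂ (pattern-of vᵢ)

  agrees-on-v₁⇒≡ : ∀ {g γ} → InO G g → Γ γ → v₁ · γ ≡ v₁ · g → g ≡ γ
  agrees-on-v₁⇒≡ {g} {γ} g∈O γ∈Γ v₁γ≡v₁g with inverse γ γ∈Γ
  ... | δ , δ∈Γ , γδ≡1 , δγ≡1 = matrix-extensionality λ v → trans (sym (δγ≡1 (v · g))) (cong (_· γ) (F≗id v))
    where
    F : Vect (suc n) → Vect (suc n)
    F = (_· δ) ∘ (_· g)
    F-fixes-v₁ : F v₁ ≡ v₁
    F-fixes-v₁ = trans (cong (_· δ) (sym v₁γ≡v₁g)) (γδ≡1 v₁)
    F≗id : ∀ v → F v ≡ v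
    F≗id = linear-fixing-basis≗id (∘-linear (·-linear δ) (·-linear g)) vs basis
      (isometry-fixing-v₁-fixes-basis (∘-isometry (O⇒isometry (⊆O δ δ∈Γ)) (O⇒isometry g∈O)) F-fixes-v₁)

  O⊆Γ : ∀ g → InO G g → Γ g
  O⊆Γ g g∈O = subst Γ (sym (agrees-on-v₁⇒≡ g∈O γ∈Γ v₁γ≡v₁g)) γ∈Γ
    where
    a = proj₁ (pattern-of v₁)
    a-pattern = proj₂ (pattern-of v₁)
    v₁g∈A : InA G a (v₁ · g)
    v₁g∈A = Isometry.preserves-A (O⇒isometry g∈O) {a} {v₁} (inMin zero , a-pattern)
    conjugating = transitive zero refl a a-pattern (v₁ · g) v₁g∈A
    γ = proj₁ conjugating
    γ∈Γ = proj₁ (proj₂ conjugating)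
    v₁γ≡v₁g = proj₂ (proj₂ conjugating)

proposition3p2 : (G : Mat 64) → ExtremalEvenUnimodular64 G →
    (Γ : Mat 64 → Set) → IsSubgroupO G Γ →
    ∃ (λ vs → Rigidifying G Γ vs) →
    ∀ (g : Mat 64) → InO G g → Γ g
proposition3p2 G L Γ Γ≤O (vs , rigidifying) = O⊆Γ symmetric posDef unimodular Γ≤O rigidifying
  where open ExtremalEvenUnimodular64 L
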